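{- Let $|q|<1$ and define the coefficients $C'(4,1,n)$ by \[ \sum_{n\geq 0}C'(4,1,n) q^n = \sum_{n\geq 0} q^{2n+1} \frac{(q^{2n+2},q^{2n+8};q^2)_\infty}{(q^{2n+1};q^2)_\infty^2}. \] Then $C'(4,1,n)\geq 0$ for all nonnegative integers $n$.
   Context: For $|q|<1$: $(a;q)_\infty=\prod_{j\geq 0}(1-aq^j)$ and $(a,b;q)_\infty=(a;q)_\infty(b;q)_\infty$. -}

module Defs where

open import Data.Nat using (ℕ; zero; suc; _∸_; _≟_) renaming (_+_ to _+ℕ_; _*_ to _*ℕ_)
open import Data.Nat.Divisibility using (_∣?_)
open import Data.Integer using (ℤ; _+_; _*_; _-_; 0ℤ; 1ℤ)
open import Relation.Nullary.Decidable using (does)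
open import Data.Bool using (if_then_else_)

-- Formal power series in q with integer coefficients: n ↦ [q^n] f.
Series : Set
Series = ℕ → ℤ

sumTo : ℕ → (ℕ → ℤ) → ℤ
sumTo zero    f = f 0
sumTo (suc n) f = sumTo n f + f (suc n)

_⊛_ : Series → Series → Series
(f ⊛ g) n = sumTo n (λ k → f k * g (n ∸ k))
infixl 7 _⊛_

one : Series
one n = if does (n ≟ 0) then 1ℤ else 0ℤ

mono : ℕ → Series
mono m n = if does (n ≟ m) then 1ℤ else 0ℤ

oneMinus : ℕ → Series
oneMinus m n = one n - mono m n

-- 1/(1 - q^m) = Σ_k q^{k m}   (used only for m ≥ 1)
geom : ℕ → Series
geom m n = if does (m ∣? n) then 1ℤ else 0ℤ

prodTo : ℕ → (ℕ → Series) → Series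
prodTo zero    F = one
prodTo (suc K) F = F K ⊛ prodTo K F

-- (q^a;q^2)_K = ∏_{j<K} (1 - q^{a+2j})
poch2 : ℕ → ℕ → Series
poch2 a K = prodTo K (λ j → oneMinus (a +ℕ 2 *ℕ j))

-- 1/(q^a;q^2)_K = ∏_{j<K} 1/(1 - q^{a+2j})
invPoch2 : ℕ → ℕ → Series
invPoch2 a K = prodTo K (λ j → geom (a +ℕ 2 *ℕ j))

-- Summand n, with the infinite products truncated to K factors:
-- q^{2n+1} (q^{2n+2},q^{2n+8};q^2)_K / (q^{2n+1};q^2)_K^2
summand : ℕ → ℕ → Series
summand n K =
  mono (2 *ℕ n +ℕ 1) ⊛ poch2 (2 *ℕ n +ℕ 2) K ⊛ poch2 (2 *ℕ n +ℕ 8) K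
    ⊛ invPoch2 (2 *ℕ n +ℕ 1) K ⊛ invPoch2 (2 *ℕ n +ℕ 1) K

-- C'(4,1,N) = [q^N] Σ_{n≥0} summand n ∞.
-- All exponents involved are ≥ 1, and factors with index j ≥ N have exponent > N,
-- so truncating the products to N+1 factors and the outer sum to n ≤ N
-- does not change the coefficient of q^N.
C'41 : ℕ → ℤ
C'41 N = sumTo N (λ n → summand n (suc N) N)

-- Write Ψ = (q²;q²)_∞/(q;q²)_∞. Then (q^{2n+2};q²)_∞/(q^{2n+1};q²)_∞ = Ψ (q;q²)_n/(q²;q²)_n, and
-- the q-binomial theorem gives (q^{2n+8};q²)_∞/(q^{2n+1};q²)_∞ = Σ_k (q⁷;q²)_k/(q²;q²)_k q^{(2n+1)k}.
-- Exchanging the sums over n and k, a second application of the q-binomial theorem collapses the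
-- series to
--   (1/(q;q²)₃) Σ_k q^{k+1} (1 - q^{2k+3}) (1 - q^{2k+5})
--     = (q/(1-q) - q⁴/(1-q³) - q⁶/(1-q³) + q⁹/(1-q⁵)) / (q;q²)₃.
-- The numerator has nonnegative coefficients, because the progressions 4 + 3ℕ and 6 + 3ℕ are disjoint
-- and lie in 1 + ℕ, and 1/(q;q²)₃ has nonnegative coefficients. Every identity is proved for the
-- truncated products and sums as an agreement of coefficients up to q^N.

module Submission where

open import Defs
open import Data.Nat using (ℕ; zero; suc; z≤n; s≤s; _∸_)
  renaming (_+_ to _+ℕ_; _*_ to _*ℕ_; _≤_ to _≤ℕ_; _<_ to _<ℕ_)
import Data.Nat as ℕ
import Data.Nat.Properties as ℕₚ
open import Data.Nat.Divisibility using (_∣_; _∣?_; divides; 1∣_; ∣-refl; ∣⇒≤; ∣m+n∣m⇒∣n; ∣m∣n⇒∣m+n)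
import Data.Nat.Tactic.RingSolver as ℕ-Solver
open import Data.Integer using (ℤ; _≤_; 0ℤ; 1ℤ; _+_; _*_; -_; _-_; +≤+)
import Data.Integer.Properties as ℤₚ
open import Data.Integer.Tactic.RingSolver using (solve-∀)
open import Data.Bool using (Bool; true; false; if_then_else_; _∧_; T)
open import Data.Unit using (tt)
open import Data.Empty using (⊥; ⊥-elim)
open import Data.Product using (_×_; _,_; proj₁)
open import Data.Sum using (_⊎_; inj₁; inj₂)
open import Relation.Nullary using (Dec; yes; no; ¬_)
open import Relation.Nullary.Decidable using (does; dec-true; dec-false)
open import Relation.Nullary.Reflects using (ofʸ; ofⁿ)
open import Relation.Binary.PropositionalEquality
  using (_≡_; _≢_; _≗_; refl; sym; trans; cong; cong₂; subst; module ≡-Reasoning)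
open import Algebra.Bundles using (CommutativeMonoid)
import Algebra.Solver.CommutativeMonoid as CommutativeMonoidSolver
import Relation.Binary.Reasoning.Setoid as SetoidReasoning

module _ where
  open ≡-Reasoning

  sumTo-cong : ∀ n {f g : ℕ → ℤ} → (∀ i → i ≤ℕ n → f i ≡ g i) → sumTo n f ≡ sumTo n g
  sumTo-cong zero    f≡g = f≡g 0 z≤n
  sumTo-cong (suc n) f≡g =
    cong₂ _+_ (sumTo-cong n (λ i i≤n → f≡g i (ℕₚ.m≤n⇒m≤1+n i≤n))) (f≡g (suc n) ℕₚ.≤-refl)

  sumTo-zero : ∀ n (f : ℕ → ℤ) → (∀ i → i ≤ℕ n → f i ≡ 0ℤ) → sumTo n f ≡ 0ℤ
  sumTo-zero zero    f f≡0 = f≡0 0 z≤n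
  sumTo-zero (suc n) f f≡0 =
    cong₂ _+_ (sumTo-zero n f (λ i i≤n → f≡0 i (ℕₚ.m≤n⇒m≤1+n i≤n))) (f≡0 (suc n) ℕₚ.≤-refl)

  sumTo-suc : ∀ n (f : ℕ → ℤ) → sumTo (suc n) f ≡ f 0 + sumTo n (λ i → f (suc i))
  sumTo-suc zero    f = refl
  sumTo-suc (suc n) f = begin
    sumTo (suc n) f + f (suc (suc n))                          ≡⟨ cong (_+ f (suc (suc n))) (sumTo-suc n f) ⟩
    f 0 + sumTo n (λ i → f (suc i)) + f (suc (suc n))          ≡⟨ ℤₚ.+-assoc (f 0) _ _ ⟩
    f 0 + sumTo (suc n) (λ i → f (suc i))                      ∎

  sumTo-+ : ∀ n (f g : ℕ → ℤ) → sumTo n (λ i → f i + g i) ≡ sumTo n f + sumTo n g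
  sumTo-+ zero    f g = refl
  sumTo-+ (suc n) f g = begin
    sumTo n (λ i → f i + g i) + (f (suc n) + g (suc n))
      ≡⟨ cong (_+ (f (suc n) + g (suc n))) (sumTo-+ n f g) ⟩
    (sumTo n f + sumTo n g) + (f (suc n) + g (suc n))
      ≡⟨ interchange (sumTo n f) (sumTo n g) (f (suc n)) (g (suc n)) ⟩
    (sumTo n f + f (suc n)) + (sumTo n g + g (suc n))
      ∎
    where
    interchange : ∀ a b c d → (a + b) + (c + d) ≡ (a + c) + (b + d)
    interchange = solve-∀

  sumTo-neg : ∀ n (f : ℕ → ℤ) → - sumTo n f ≡ sumTo n (λ i → - f i)
  sumTo-neg zero    f = refl
  sumTo-neg (suc n) f =
    trans (ℤₚ.neg-distrib-+ (sumTo n f) (f (suc n))) (cong (_+ - f (suc n)) (sumTo-neg n f))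

  sumTo-*ˡ : ∀ n c (f : ℕ → ℤ) → c * sumTo n f ≡ sumTo n (λ i → c * f i)
  sumTo-*ˡ zero    c f = refl
  sumTo-*ˡ (suc n) c f =
    trans (ℤₚ.*-distribˡ-+ c (sumTo n f) (f (suc n))) (cong (_+ c * f (suc n)) (sumTo-*ˡ n c f))

  sumTo-*ʳ : ∀ n c (f : ℕ → ℤ) → sumTo n f * c ≡ sumTo n (λ i → f i * c)
  sumTo-*ʳ n c f = begin
    sumTo n f * c                ≡⟨ ℤₚ.*-comm (sumTo n f) c ⟩
    c * sumTo n f                ≡⟨ sumTo-*ˡ n c f ⟩
    sumTo n (λ i → c * f i)      ≡⟨ sumTo-cong n (λ i _ → ℤₚ.*-comm c (f i)) ⟩
    sumTo n (λ i → f i * c)      ∎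

  sumTo-pick : ∀ n c (f : ℕ → ℤ) → c ≤ℕ n → (∀ i → i ≤ℕ n → i ≢ c → f i ≡ 0ℤ) → sumTo n f ≡ f c
  sumTo-pick zero    .zero f z≤n _ = refl
  sumTo-pick (suc n) c f c≤1+n f≡0 with ℕₚ.m≤n⇒m<n∨m≡n c≤1+n
  ... | inj₁ (s≤s c≤n) = begin
    sumTo n f + f (suc n)   ≡⟨ cong₂ _+_ (sumTo-pick n c f c≤n (λ i i≤n → f≡0 i (ℕₚ.m≤n⇒m≤1+n i≤n)))
                                         (f≡0 (suc n) ℕₚ.≤-refl (ℕₚ.>⇒≢ (s≤s c≤n))) ⟩
    f c + 0ℤ                ≡⟨ ℤₚ.+-identityʳ (f c) ⟩
    f c                     ∎
  ... | inj₂ refl = begin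
    sumTo n f + f (suc n)
      ≡⟨ cong (_+ f (suc n)) (sumTo-zero n f (λ i i≤n → f≡0 i (ℕₚ.m≤n⇒m≤1+n i≤n) (ℕₚ.<⇒≢ (s≤s i≤n)))) ⟩
    0ℤ + f (suc n)
      ≡⟨ ℤₚ.+-identityˡ (f (suc n)) ⟩
    f (suc n)
      ∎

  sumTo-reverse : ∀ n (f : ℕ → ℤ) → sumTo n f ≡ sumTo n (λ k → f (n ∸ k))
  sumTo-reverse zero    f = refl
  sumTo-reverse (suc n) f = begin
    sumTo n f + f (suc n)                           ≡⟨ cong (_+ f (suc n)) (sumTo-reverse n f) ⟩
    sumTo n (λ k → f (n ∸ k)) + f (suc n)           ≡⟨ ℤₚ.+-comm _ (f (suc n)) ⟩
    f (suc n) + sumTo n (λ k → f (n ∸ k))           ≡⟨ sumTo-suc n (λ k → f (suc n ∸ k)) ⟨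
    sumTo (suc n) (λ k → f (suc n ∸ k))             ∎

  sumTo-comm : ∀ n m (F : ℕ → ℕ → ℤ) →
               sumTo n (λ i → sumTo m (F i)) ≡ sumTo m (λ j → sumTo n (λ i → F i j))
  sumTo-comm zero    m F = refl
  sumTo-comm (suc n) m F = begin
    sumTo n (λ i → sumTo m (F i)) + sumTo m (F (suc n))
      ≡⟨ cong (_+ sumTo m (F (suc n))) (sumTo-comm n m F) ⟩
    sumTo m (λ j → sumTo n (λ i → F i j)) + sumTo m (F (suc n))
      ≡⟨ sumTo-+ m _ (F (suc n)) ⟨
    sumTo m (λ j → sumTo (suc n) (λ i → F i j))
      ∎

  sumTo-triangle : ∀ n (F : ℕ → ℕ → ℤ) →
    sumTo n (λ k → sumTo k (λ i → F i k)) ≡ sumTo n (λ i → sumTo (n ∸ i) (λ j → F i (i +ℕ j)))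
  sumTo-triangle zero    F = refl
  sumTo-triangle (suc n) F = begin
    sumTo n (λ k → sumTo k (λ i → F i k)) + (column + F (suc n) (suc n))
      ≡⟨ cong (_+ (column + F (suc n) (suc n))) (sumTo-triangle n F) ⟩
    rows + (column + F (suc n) (suc n))
      ≡⟨ ℤₚ.+-assoc rows column (F (suc n) (suc n)) ⟨
    (rows + column) + F (suc n) (suc n)
      ≡⟨ cong₂ _+_ (trans (sym (sumTo-+ n _ _)) (sumTo-cong n extend-row))
                   (cong (F (suc n)) (sym (ℕₚ.+-identityʳ (suc n)))) ⟩
    sumTo n (λ i → sumTo (suc n ∸ i) (row i)) + F (suc n) (suc n +ℕ 0)
      ≡⟨ cong (λ m → sumTo n (λ i → sumTo (suc n ∸ i) (row i)) + sumTo m (row (suc n))) (ℕₚ.n∸n≡0 n) ⟨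
    sumTo (suc n) (λ i → sumTo (suc n ∸ i) (row i))
      ∎
    where
    row : ℕ → ℕ → ℤ
    row i j = F i (i +ℕ j)
    rows column : ℤ
    rows   = sumTo n (λ i → sumTo (n ∸ i) (row i))
    column = sumTo n (λ i → F i (suc n))
    extend-row : ∀ i → i ≤ℕ n → sumTo (n ∸ i) (row i) + F i (suc n) ≡ sumTo (suc n ∸ i) (row i)
    extend-row i i≤n rewrite ℕₚ.+-∸-assoc 1 i≤n =
      cong (λ m → sumTo (n ∸ i) (row i) + F i m) (sym (trans (ℕₚ.+-suc i (n ∸ i)) (cong suc (ℕₚ.m+[n∸m]≡n i≤n))))

  sumTo-telescope : ∀ n (d r : ℕ → ℤ) →
    sumTo n (λ j → (d j - d (suc j)) + r j) ≡ (d 0 - d (suc n)) + sumTo n r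
  sumTo-telescope zero    d r = refl
  sumTo-telescope (suc n) d r =
    trans (cong (_+ ((d (suc n) - d (suc (suc n))) + r (suc n))) (sumTo-telescope n d r))
          (regroup (d 0) (d (suc n)) (d (suc (suc n))) (sumTo n r) (r (suc n)))
    where
    regroup : ∀ a b c s t → ((a - b) + s) + ((b - c) + t) ≡ (a - c) + (s + t)
    regroup = solve-∀

  sumTo-nonneg : ∀ n (f : ℕ → ℤ) → (∀ i → i ≤ℕ n → 0ℤ ≤ f i) → 0ℤ ≤ sumTo n f
  sumTo-nonneg zero    f 0≤f = 0≤f 0 z≤n
  sumTo-nonneg (suc n) f 0≤f =
    ℤₚ.+-mono-≤ (sumTo-nonneg n f (λ i i≤n → 0≤f i (ℕₚ.m≤n⇒m≤1+n i≤n))) (0≤f (suc n) ℕₚ.≤-refl)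

infixl 6 _⊕_
_⊕_ : Series → Series → Series
(f ⊕ g) n = f n + g n

⊖_ : Series → Series
(⊖ f) n = - f n

𝟘 : Series
𝟘 _ = 0ℤ

indicator : Bool → ℤ
indicator b = if b then 1ℤ else 0ℤ

mono-refl : ∀ m → mono m m ≡ 1ℤ
mono-refl m = cong indicator (dec-true (m ℕ.≟ m) refl)

mono-≢ : ∀ m k → k ≢ m → mono m k ≡ 0ℤ
mono-≢ m k k≢m = cong indicator (dec-false (k ℕ.≟ m) k≢m)

geom-∣ : ∀ m k → m ∣ k → geom m k ≡ 1ℤ
geom-∣ m k m∣k = cong indicator (dec-true (m ∣? k) m∣k)

geom-∤ : ∀ m k → ¬ m ∣ k → geom m k ≡ 0ℤ
geom-∤ m k m∤k = cong indicator (dec-false (m ∣? k) m∤k)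

module _ where
  open ≡-Reasoning

  ⊛-comm : ∀ f g → f ⊛ g ≗ g ⊛ f
  ⊛-comm f g n = begin
    sumTo n (λ k → f k * g (n ∸ k))
      ≡⟨ sumTo-reverse n _ ⟩
    sumTo n (λ k → f (n ∸ k) * g (n ∸ (n ∸ k)))
      ≡⟨ sumTo-cong n (λ k k≤n → cong (λ i → f (n ∸ k) * g i) (ℕₚ.m∸[m∸n]≡n k≤n)) ⟩
    sumTo n (λ k → f (n ∸ k) * g k)
      ≡⟨ sumTo-cong n (λ k _ → ℤₚ.*-comm (f (n ∸ k)) (g k)) ⟩
    sumTo n (λ k → g k * f (n ∸ k))
      ∎

  ⊛-assoc : ∀ f g h → (f ⊛ g) ⊛ h ≗ f ⊛ (g ⊛ h)
  ⊛-assoc f g h n = begin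
    sumTo n (λ k → sumTo k (λ i → f i * g (k ∸ i)) * h (n ∸ k))
      ≡⟨ sumTo-cong n (λ k _ → sumTo-*ʳ k (h (n ∸ k)) _) ⟩
    sumTo n (λ k → sumTo k (λ i → f i * g (k ∸ i) * h (n ∸ k)))
      ≡⟨ sumTo-triangle n (λ i k → f i * g (k ∸ i) * h (n ∸ k)) ⟩
    sumTo n (λ i → sumTo (n ∸ i) (λ j → f i * g (i +ℕ j ∸ i) * h (n ∸ (i +ℕ j))))
      ≡⟨ sumTo-cong n (λ i _ → sumTo-cong (n ∸ i) (λ j _ → reindex i j)) ⟩
    sumTo n (λ i → sumTo (n ∸ i) (λ j → f i * (g j * h (n ∸ i ∸ j))))
      ≡⟨ sumTo-cong n (λ i _ → sumTo-*ˡ (n ∸ i) (f i) _) ⟨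
    sumTo n (λ i → f i * sumTo (n ∸ i) (λ j → g j * h (n ∸ i ∸ j)))
      ∎
    where
    reindex : ∀ i j → f i * g (i +ℕ j ∸ i) * h (n ∸ (i +ℕ j)) ≡ f i * (g j * h (n ∸ i ∸ j))
    reindex i j rewrite ℕₚ.m+n∸m≡n i j | sym (ℕₚ.∸-+-assoc n i j) = ℤₚ.*-assoc (f i) (g j) _

  ⊛-distribˡ : ∀ f g h → f ⊛ (g ⊕ h) ≗ f ⊛ g ⊕ f ⊛ h
  ⊛-distribˡ f g h n =
    trans (sumTo-cong n (λ k _ → ℤₚ.*-distribˡ-+ (f k) (g (n ∸ k)) (h (n ∸ k)))) (sumTo-+ n _ _)

  ⊛-distribʳ : ∀ f g h → (f ⊕ g) ⊛ h ≗ f ⊛ h ⊕ g ⊛ h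
  ⊛-distribʳ f g h n = begin
    ((f ⊕ g) ⊛ h) n        ≡⟨ ⊛-comm (f ⊕ g) h n ⟩
    (h ⊛ (f ⊕ g)) n        ≡⟨ ⊛-distribˡ h f g n ⟩
    (h ⊛ f) n + (h ⊛ g) n  ≡⟨ cong₂ _+_ (⊛-comm h f n) (⊛-comm h g n) ⟩
    (f ⊛ h) n + (g ⊛ h) n  ∎

  ⊛-negʳ : ∀ f g → f ⊛ (⊖ g) ≗ ⊖ (f ⊛ g)
  ⊛-negʳ f g n =
    trans (sumTo-cong n (λ k _ → sym (ℤₚ.neg-distribʳ-* (f k) (g (n ∸ k))))) (sym (sumTo-neg n _))

  ⊛-zeroʳ : ∀ f → f ⊛ 𝟘 ≗ 𝟘
  ⊛-zeroʳ f n = sumTo-zero n _ (λ i _ → ℤₚ.*-zeroʳ (f i))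

  ⊛-identityˡ : ∀ f → one ⊛ f ≗ f
  ⊛-identityˡ f n = trans (sumTo-pick n 0 _ z≤n one-vanishes) (ℤₚ.*-identityˡ (f n))
    where
    one-vanishes : ∀ i → i ≤ℕ n → i ≢ 0 → one i * f (n ∸ i) ≡ 0ℤ
    one-vanishes zero    _ i≢0 = ⊥-elim (i≢0 refl)
    one-vanishes (suc i) _ _   = refl

  ⊛-identityʳ : ∀ f → f ⊛ one ≗ f
  ⊛-identityʳ f n = trans (⊛-comm f one n) (⊛-identityˡ f n)

  ⊛-mono : ∀ f m n → m ≤ℕ n → (f ⊛ mono m) n ≡ f (n ∸ m)
  ⊛-mono f m n m≤n = begin
    sumTo n (λ k → f k * mono m (n ∸ k))   ≡⟨ sumTo-pick n (n ∸ m) _ (ℕₚ.m∸n≤m n m) off-diagonal ⟩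
    f (n ∸ m) * mono m (n ∸ (n ∸ m))       ≡⟨ cong (λ i → f (n ∸ m) * mono m i) (ℕₚ.m∸[m∸n]≡n m≤n) ⟩
    f (n ∸ m) * mono m m                   ≡⟨ cong (f (n ∸ m) *_) (mono-refl m) ⟩
    f (n ∸ m) * 1ℤ                         ≡⟨ ℤₚ.*-identityʳ (f (n ∸ m)) ⟩
    f (n ∸ m)                              ∎
    where
    off-diagonal : ∀ i → i ≤ℕ n → i ≢ n ∸ m → f i * mono m (n ∸ i) ≡ 0ℤ
    off-diagonal i i≤n i≢n∸m = trans
      (cong (f i *_) (mono-≢ m (n ∸ i) (λ n∸i≡m → i≢n∸m (trans (sym (ℕₚ.m∸[m∸n]≡n i≤n)) (cong (n ∸_) n∸i≡m)))))
      (ℤₚ.*-zeroʳ (f i))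

  ⊛-mono-< : ∀ f m n → n <ℕ m → (f ⊛ mono m) n ≡ 0ℤ
  ⊛-mono-< f m n n<m = sumTo-zero n _ (λ i _ →
    trans (cong (f i *_) (mono-≢ m (n ∸ i) (ℕₚ.<⇒≢ (ℕₚ.≤-<-trans (ℕₚ.m∸n≤m n i) n<m))))
          (ℤₚ.*-zeroʳ (f i)))

  mono-+ : ∀ a b → mono a ⊛ mono b ≗ mono (a +ℕ b)
  mono-+ a b n with b ℕ.≤? n
  ... | no b≰n = trans (⊛-mono-< (mono a) b n (ℕₚ.≰⇒> b≰n))
                       (sym (mono-≢ (a +ℕ b) n (λ n≡a+b → b≰n (subst (b ≤ℕ_) (sym n≡a+b) (ℕₚ.m≤n+m b a)))))
  ... | yes b≤n with n ℕ.≟ a +ℕ b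
  ...   | yes refl = trans (⊛-mono (mono a) b n b≤n)
                           (trans (cong (mono a) (ℕₚ.m+n∸n≡m a b)) (trans (mono-refl a) (sym (mono-refl (a +ℕ b)))))
  ...   | no n≢a+b = trans (⊛-mono (mono a) b n b≤n)
                           (trans (mono-≢ a (n ∸ b) (λ n∸b≡a → n≢a+b (trans (sym (ℕₚ.m∸n+n≡m b≤n)) (cong (_+ℕ b) n∸b≡a))))
                                  (sym (mono-≢ (a +ℕ b) n n≢a+b)))

  oneMinus-⊛ : ∀ m f → oneMinus m ⊛ f ≗ f ⊕ ⊖ (mono m ⊛ f)
  oneMinus-⊛ m f n = begin
    (oneMinus m ⊛ f) n
      ≡⟨ ⊛-distribʳ one (⊖ mono m) f n ⟩
    (one ⊛ f) n + ((⊖ mono m) ⊛ f) n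
      ≡⟨ cong₂ _+_ (⊛-identityˡ f n) (trans (⊛-comm (⊖ mono m) f n) (⊛-negʳ f (mono m) n)) ⟩
    f n - (f ⊛ mono m) n
      ≡⟨ cong (λ x → f n - x) (⊛-comm f (mono m) n) ⟩
    f n - (mono m ⊛ f) n
      ∎

  oneMinus⊛mono : ∀ m b → oneMinus m ⊛ mono b ≗ mono b ⊕ ⊖ mono (m +ℕ b)
  oneMinus⊛mono m b n = trans (oneMinus-⊛ m (mono b) n) (cong (λ x → mono b n - x) (mono-+ m b n))

  geom-⊛-oneMinus : ∀ m → 1 ≤ℕ m → geom m ⊛ oneMinus m ≗ one
  geom-⊛-oneMinus m 1≤m n = begin
    (geom m ⊛ oneMinus m) n          ≡⟨ trans (⊛-comm (geom m) (oneMinus m) n) (oneMinus-⊛ m (geom m) n) ⟩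
    geom m n - (mono m ⊛ geom m) n   ≡⟨ cong (λ x → geom m n - x) (⊛-comm (mono m) (geom m) n) ⟩
    geom m n - (geom m ⊛ mono m) n   ≡⟨ telescoped (m ℕ.≤? n) ⟩
    one n                            ∎
    where
    telescoped : Dec (m ≤ℕ n) → geom m n - (geom m ⊛ mono m) n ≡ one n
    telescoped (no m≰n) rewrite ⊛-mono-< (geom m) m n (ℕₚ.≰⇒> m≰n) =
      trans (ℤₚ.+-identityʳ (geom m n)) (below n (ℕₚ.≰⇒> m≰n))
      where
      below : ∀ n → n <ℕ m → geom m n ≡ one n
      below zero    _   = geom-∣ m 0 (divides 0 refl)
      below (suc n) n<m = geom-∤ m (suc n) (λ m∣n → ℕₚ.<⇒≱ n<m (∣⇒≤ m∣n))
    telescoped (yes m≤n) rewrite ⊛-mono (geom m) m n m≤n =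
      trans (cong (_- geom m (n ∸ m)) (periodic (m ∣? (n ∸ m)))) (trans (ℤₚ.+-inverseʳ (geom m (n ∸ m))) (above n m≤n))
      where
      n≡m+[n∸m] : n ≡ m +ℕ (n ∸ m)
      n≡m+[n∸m] = sym (ℕₚ.m+[n∸m]≡n m≤n)
      periodic : Dec (m ∣ (n ∸ m)) → geom m n ≡ geom m (n ∸ m)
      periodic (yes m∣n∸m) = trans (geom-∣ m n (subst (m ∣_) (sym n≡m+[n∸m]) (∣m∣n⇒∣m+n ∣-refl m∣n∸m)))
                                   (sym (geom-∣ m (n ∸ m) m∣n∸m))
      periodic (no m∤n∸m)  = trans (geom-∤ m n (λ m∣n → m∤n∸m (∣m+n∣m⇒∣n (subst (m ∣_) n≡m+[n∸m] m∣n) ∣-refl)))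
                                   (sym (geom-∤ m (n ∸ m) m∤n∸m))
      above : ∀ n → m ≤ℕ n → 0ℤ ≡ one n
      above zero    m≤0 = ⊥-elim (ℕₚ.<⇒≱ 1≤m m≤0)
      above (suc n) _   = refl

sumˢ : ℕ → (ℕ → Series) → Series
sumˢ M F k = sumTo M (λ j → F j k)

⊛-sumˢ : ∀ f M (F : ℕ → Series) → f ⊛ sumˢ M F ≗ sumˢ M (λ j → f ⊛ F j)
⊛-sumˢ f M F n = trans (sumTo-cong n (λ k _ → sumTo-*ˡ M (f k) (λ j → F j (n ∸ k))))
                       (sumTo-comm n M (λ k j → f k * F j (n ∸ k)))

sumˢ-comm : ∀ A B (X : ℕ → ℕ → Series) → sumˢ A (λ i → sumˢ B (X i)) ≗ sumˢ B (λ j → sumˢ A (λ i → X i j))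
sumˢ-comm A B X n = sumTo-comm A B (λ i j → X i j n)

-- poch2 a K and invPoch2 a K are, definitionally, stepProd oneMinus a K and stepProd geom a K.
stepProd : (ℕ → Series) → ℕ → ℕ → Series
stepProd h a K = prodTo K (λ j → h (a +ℕ 2 *ℕ j))

mono-exchange : ∀ a b c d → a +ℕ b ≡ c +ℕ d → mono a ⊛ mono b ≗ mono c ⊛ mono d
mono-exchange a b c d a+b≡c+d n =
  trans (mono-+ a b n) (trans (cong (λ m → mono m n) a+b≡c+d) (sym (mono-+ c d n)))

sumˢ-⊛ : ∀ M (F : ℕ → Series) f → sumˢ M F ⊛ f ≗ sumˢ M (λ j → F j ⊛ f)
sumˢ-⊛ M F f n = trans (⊛-comm (sumˢ M F) f n)
  (trans (⊛-sumˢ f M F n) (sumTo-cong M (λ j _ → ⊛-comm f (F j) n)))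

sumˢ-difference : ∀ M (F G : ℕ → Series) → sumˢ M (λ j → F j ⊕ ⊖ G j) ≗ sumˢ M F ⊕ ⊖ sumˢ M G
sumˢ-difference M F G n =
  trans (sumTo-+ M (λ j → F j n) (λ j → - G j n)) (cong (sumˢ M F n +_) (sym (sumTo-neg M (λ j → G j n))))

closedForm : Series
closedForm = (mono 1 ⊛ geom 1 ⊕ ⊖ (mono 4 ⊛ geom 3)) ⊕ ⊖ (mono 6 ⊛ geom 3 ⊕ ⊖ (mono 9 ⊛ geom 5))

module UpTo (N : ℕ) where

  infix 4 _≈_
  record _≈_ (f g : Series) : Set where
    constructor agree
    field at : ∀ k → k ≤ℕ N → f k ≡ g k
  open _≈_ public

  ≗⇒≈ : ∀ {f g} → f ≗ g → f ≈ g
  ≗⇒≈ f≗g = agree λ k _ → f≗g k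

  ⊛-cong : ∀ {f f′ g g′} → f ≈ f′ → g ≈ g′ → f ⊛ g ≈ f′ ⊛ g′
  ⊛-cong f≈f′ g≈g′ = agree λ k k≤N → sumTo-cong k (λ i i≤k →
    cong₂ _*_ (at f≈f′ i (ℕₚ.≤-trans i≤k k≤N)) (at g≈g′ (k ∸ i) (ℕₚ.≤-trans (ℕₚ.m∸n≤m k i) k≤N)))

  ⊛-commutativeMonoid : CommutativeMonoid _ _
  ⊛-commutativeMonoid = record
    { Carrier = Series ; _≈_ = _≈_ ; _∙_ = _⊛_ ; ε = one
    ; isCommutativeMonoid = record
      { isMonoid = record
        { isSemigroup = record
          { isMagma = record
            { isEquivalence = record
              { refl  = agree λ _ _ → refl
              ; sym   = λ f≈g → agree λ k k≤N → sym (at f≈g k k≤N)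
              ; trans = λ f≈g g≈h → agree λ k k≤N → trans (at f≈g k k≤N) (at g≈h k k≤N) }
            ; ∙-cong = ⊛-cong }
          ; assoc = λ f g h → ≗⇒≈ (⊛-assoc f g h) }
        ; identity = (λ f → ≗⇒≈ (⊛-identityˡ f)) , (λ f → ≗⇒≈ (⊛-identityʳ f)) }
      ; comm = λ f g → ≗⇒≈ (⊛-comm f g) } }

  open CommutativeMonoid ⊛-commutativeMonoid
    using () renaming (setoid to ≈-setoid; refl to ≈-refl; sym to ≈-sym; trans to ≈-trans; reflexive to ≈-reflexive)
  open CommutativeMonoidSolver ⊛-commutativeMonoid
    using (solve; _⊜_) renaming (_⊕_ to _·_; id to ε)
  open SetoidReasoning ≈-setoid

  ⊛-congˡ : ∀ {f f′} g → f ≈ f′ → f ⊛ g ≈ f′ ⊛ g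
  ⊛-congˡ g f≈f′ = ⊛-cong f≈f′ (≈-refl {g})

  ⊛-congʳ : ∀ f {g g′} → g ≈ g′ → f ⊛ g ≈ f ⊛ g′
  ⊛-congʳ f g≈g′ = ⊛-cong (≈-refl {f}) g≈g′

  ⊕-cong : ∀ {f f′ g g′} → f ≈ f′ → g ≈ g′ → f ⊕ g ≈ f′ ⊕ g′
  ⊕-cong f≈f′ g≈g′ = agree λ k k≤N → cong₂ _+_ (at f≈f′ k k≤N) (at g≈g′ k k≤N)

  ⊖-cong : ∀ {f f′} → f ≈ f′ → ⊖ f ≈ ⊖ f′
  ⊖-cong f≈f′ = agree λ k k≤N → cong -_ (at f≈f′ k k≤N)

  sumˢ-cong : ∀ M {F G : ℕ → Series} → (∀ j → j ≤ℕ M → F j ≈ G j) → sumˢ M F ≈ sumˢ M G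
  sumˢ-cong M F≈G = agree λ k k≤N → sumTo-cong M (λ j j≤M → at (F≈G j j≤M) k k≤N)

  cancelʳ : ∀ f {g} → g ≈ one → f ⊛ g ≈ f
  cancelʳ f g≈1 = ≈-trans (⊛-congʳ f g≈1) (≗⇒≈ (⊛-identityʳ f))

  cross-multiply : ∀ a b b′ c d d′ → a ⊛ d ≈ c ⊛ b → b ⊛ b′ ≈ one → d ⊛ d′ ≈ one → a ⊛ b′ ≈ c ⊛ d′
  cross-multiply a b b′ c d d′ a⊛d≈c⊛b b⊛b′≈1 d⊛d′≈1 = begin
    a ⊛ b′                 ≈⟨ cancelʳ (a ⊛ b′) d⊛d′≈1 ⟨
    (a ⊛ b′) ⊛ (d ⊛ d′)    ≈⟨ solve 4 (λ a b′ d d′ → (a · b′) · (d · d′) ⊜ (a · d) · (b′ · d′)) ≈-refl a b′ d d′ ⟩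
    (a ⊛ d) ⊛ (b′ ⊛ d′)    ≈⟨ ⊛-congˡ (b′ ⊛ d′) a⊛d≈c⊛b ⟩
    (c ⊛ b) ⊛ (b′ ⊛ d′)    ≈⟨ solve 4 (λ c b b′ d′ → (c · b) · (b′ · d′) ⊜ (c · d′) · (b · b′)) ≈-refl c b b′ d′ ⟩
    (c ⊛ d′) ⊛ (b ⊛ b′)    ≈⟨ cancelʳ (c ⊛ d′) b⊛b′≈1 ⟩
    c ⊛ d′                 ∎

  mono-vanishes : ∀ a → N <ℕ a → mono a ≈ 𝟘
  mono-vanishes a N<a = agree λ k k≤N → mono-≢ a k (ℕₚ.<⇒≢ (ℕₚ.≤-<-trans k≤N N<a))

  ⊛-mono-vanishes : ∀ f a → N <ℕ a → f ⊛ mono a ≈ 𝟘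
  ⊛-mono-vanishes f a N<a = ≈-trans (⊛-congʳ f (mono-vanishes a N<a)) (≗⇒≈ (⊛-zeroʳ f))

  oneMinus≈one : ∀ a → N <ℕ a → oneMinus a ≈ one
  oneMinus≈one a N<a = agree λ k k≤N →
    trans (cong (λ x → one k - x) (at (mono-vanishes a N<a) k k≤N)) (ℤₚ.+-identityʳ (one k))

  geom≈one : ∀ a → N <ℕ a → geom a ≈ one
  geom≈one a N<a = agree coefficients
    where
    coefficients : ∀ k → k ≤ℕ N → geom a k ≡ one k
    coefficients zero    _   = geom-∣ a 0 (divides 0 refl)
    coefficients (suc k) k<N = geom-∤ a (suc k) (λ a∣k → ℕₚ.<⇒≱ (ℕₚ.≤-<-trans k<N N<a) (∣⇒≤ a∣k))

  prodTo-cong : ∀ K {F G : ℕ → Series} → (∀ j → j <ℕ K → F j ≈ G j) → prodTo K F ≈ prodTo K G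
  prodTo-cong zero    F≈G = ≈-refl
  prodTo-cong (suc K) F≈G = ⊛-cong (F≈G K ℕₚ.≤-refl) (prodTo-cong K (λ j j<K → F≈G j (ℕₚ.m≤n⇒m≤1+n j<K)))

  prodTo-≈one : ∀ K (F : ℕ → Series) → (∀ j → j <ℕ K → F j ≈ one) → prodTo K F ≈ one
  prodTo-≈one K F F≈1 = ≈-trans (prodTo-cong K F≈1) (all-one K)
    where
    all-one : ∀ K → prodTo K (λ _ → one) ≈ one
    all-one zero    = ≈-refl
    all-one (suc K) = ≈-trans (⊛-congʳ one (all-one K)) (≗⇒≈ (⊛-identityˡ one))

  prodTo-+ : ∀ L K (F : ℕ → Series) → prodTo (L +ℕ K) F ≈ prodTo L (λ j → F (K +ℕ j)) ⊛ prodTo K F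
  prodTo-+ zero    K F = ≈-sym (≗⇒≈ (⊛-identityˡ (prodTo K F)))
  prodTo-+ (suc L) K F = begin
    F (L +ℕ K) ⊛ prodTo (L +ℕ K) F
      ≈⟨ ⊛-cong (≈-reflexive (cong F (ℕₚ.+-comm L K))) (prodTo-+ L K F) ⟩
    F (K +ℕ L) ⊛ (prodTo L (λ j → F (K +ℕ j)) ⊛ prodTo K F)
      ≈⟨ ≗⇒≈ (⊛-assoc (F (K +ℕ L)) (prodTo L (λ j → F (K +ℕ j))) (prodTo K F)) ⟨
    (F (K +ℕ L) ⊛ prodTo L (λ j → F (K +ℕ j))) ⊛ prodTo K F
      ∎

  prodTo-⊛ : ∀ K (F G : ℕ → Series) → prodTo K F ⊛ prodTo K G ≈ prodTo K (λ j → F j ⊛ G j)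
  prodTo-⊛ zero    F G = ≗⇒≈ (⊛-identityˡ one)
  prodTo-⊛ (suc K) F G = begin
    (F K ⊛ prodTo K F) ⊛ (G K ⊛ prodTo K G)
      ≈⟨ solve 4 (λ a b c d → (a · b) · (c · d) ⊜ (a · c) · (b · d)) ≈-refl (F K) (prodTo K F) (G K) (prodTo K G) ⟩
    (F K ⊛ G K) ⊛ (prodTo K F ⊛ prodTo K G)
      ≈⟨ ⊛-congʳ (F K ⊛ G K) (prodTo-⊛ K F G) ⟩
    (F K ⊛ G K) ⊛ prodTo K (λ j → F j ⊛ G j)
      ∎

  stepProd-+ : ∀ h a L K → stepProd h a (L +ℕ K) ≈ stepProd h (a +ℕ 2 *ℕ K) L ⊛ stepProd h a K
  stepProd-+ h a L K = ≈-trans (prodTo-+ L K (λ j → h (a +ℕ 2 *ℕ j)))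
    (⊛-congˡ (stepProd h a K) (prodTo-cong L (λ j _ → ≈-reflexive (cong h (shift a K j)))))
    where
    shift : ∀ a K j → a +ℕ 2 *ℕ (K +ℕ j) ≡ (a +ℕ 2 *ℕ K) +ℕ 2 *ℕ j
    shift = ℕ-Solver.solve-∀

  stepProd-peel : ∀ h a K k → (∀ x → N <ℕ x → h x ≈ one) → N <ℕ a +ℕ 2 *ℕ K →
                  stepProd h a K ≈ stepProd h (a +ℕ 2 *ℕ k) K ⊛ stepProd h a k
  stepProd-peel h a K k h≈1 N<a+2K = begin
    stepProd h a K                                       ≈⟨ ≗⇒≈ (⊛-identityˡ (stepProd h a K)) ⟨
    one ⊛ stepProd h a K                                 ≈⟨ ⊛-congˡ (stepProd h a K) (prodTo-≈one k _ beyond-N) ⟨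
    stepProd h (a +ℕ 2 *ℕ K) k ⊛ stepProd h a K          ≈⟨ stepProd-+ h a k K ⟨
    stepProd h a (k +ℕ K)                                ≈⟨ ≈-reflexive (cong (stepProd h a) (ℕₚ.+-comm k K)) ⟩
    stepProd h a (K +ℕ k)                                ≈⟨ stepProd-+ h a K k ⟩
    stepProd h (a +ℕ 2 *ℕ k) K ⊛ stepProd h a k          ∎
    where
    beyond-N : ∀ j → j <ℕ k → h ((a +ℕ 2 *ℕ K) +ℕ 2 *ℕ j) ≈ one
    beyond-N j _ = h≈1 _ (ℕₚ.<-≤-trans N<a+2K (ℕₚ.m≤m+n (a +ℕ 2 *ℕ K) (2 *ℕ j)))

  poch2-⊛-invPoch2 : ∀ a K → 1 ≤ℕ a → poch2 a K ⊛ invPoch2 a K ≈ one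
  poch2-⊛-invPoch2 a K 1≤a = ≈-trans (prodTo-⊛ K _ _) (prodTo-≈one K _ λ j _ → ≗⇒≈ λ n →
    trans (⊛-comm (oneMinus (a +ℕ 2 *ℕ j)) (geom (a +ℕ 2 *ℕ j)) n)
          (geom-⊛-oneMinus (a +ℕ 2 *ℕ j) (ℕₚ.≤-trans 1≤a (ℕₚ.m≤m+n a (2 *ℕ j))) n))

  ⊛-mono-+ : ∀ f a b c → a +ℕ b ≡ c → mono a ⊛ (f ⊛ mono b) ≈ f ⊛ mono c
  ⊛-mono-+ f a b c a+b≡c = begin
    mono a ⊛ (f ⊛ mono b)   ≈⟨ solve 3 (λ x y z → x · (y · z) ⊜ y · (x · z)) ≈-refl (mono a) f (mono b) ⟩
    f ⊛ (mono a ⊛ mono b)   ≈⟨ ⊛-congʳ f (≗⇒≈ (mono-+ a b)) ⟩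
    f ⊛ mono (a +ℕ b)       ≈⟨ ≈-reflexive (cong (λ m → f ⊛ mono m) a+b≡c) ⟩
    f ⊛ mono c              ∎

  oneMinus-⊛-mono : ∀ f m b c → m +ℕ b ≡ c → oneMinus m ⊛ (f ⊛ mono b) ≈ f ⊛ mono b ⊕ ⊖ (f ⊛ mono c)
  oneMinus-⊛-mono f m b c m+b≡c =
    ≈-trans (≗⇒≈ (oneMinus-⊛ m (f ⊛ mono b))) (⊕-cong (≈-refl {f ⊛ mono b}) (⊖-cong (⊛-mono-+ f m b c m+b≡c)))

  module QBinomial (α : ℕ) where

    coeff : ℕ → Series
    coeff j = poch2 α j ⊛ invPoch2 2 j

    series : ℕ → Series
    series s = sumˢ N (λ j → coeff j ⊛ mono (s *ℕ j))

    coeff-suc : ∀ j → coeff (suc j) ⊛ oneMinus (2 *ℕ suc j) ≈ coeff j ⊛ oneMinus (α +ℕ 2 *ℕ j)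
    coeff-suc j = begin
      ((A ⊛ P) ⊛ (G ⊛ I)) ⊛ oneMinus (2 *ℕ suc j)
        ≈⟨ ⊛-congʳ ((A ⊛ P) ⊛ (G ⊛ I)) (≈-reflexive (cong oneMinus (ℕₚ.*-suc 2 j))) ⟩
      ((A ⊛ P) ⊛ (G ⊛ I)) ⊛ O
        ≈⟨ solve 5 (λ a p g i o → ((a · p) · (g · i)) · o ⊜ ((p · i) · a) · (g · o)) ≈-refl A P G I O ⟩
      ((P ⊛ I) ⊛ A) ⊛ (G ⊛ O)
        ≈⟨ cancelʳ ((P ⊛ I) ⊛ A) (≗⇒≈ (geom-⊛-oneMinus (2 +ℕ 2 *ℕ j) (s≤s z≤n))) ⟩
      (P ⊛ I) ⊛ A
        ∎
      where
      A P G I O : Series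
      A = oneMinus (α +ℕ 2 *ℕ j)
      P = poch2 α j
      G = geom (2 +ℕ 2 *ℕ j)
      I = invPoch2 2 j
      O = oneMinus (2 +ℕ 2 *ℕ j)

    term : ℕ → ℕ → Series
    term s j = (coeff j ⊛ oneMinus (2 *ℕ j)) ⊛ mono (s *ℕ j)

    term-zero : ∀ s → term s 0 ≈ 𝟘
    term-zero s = begin
      (coeff 0 ⊛ oneMinus 0) ⊛ mono (s *ℕ 0)   ≈⟨ ⊛-congˡ (mono (s *ℕ 0)) (⊛-congʳ (coeff 0) (≗⇒≈ oneMinus-zero)) ⟩
      (coeff 0 ⊛ 𝟘) ⊛ mono (s *ℕ 0)            ≈⟨ ⊛-congˡ (mono (s *ℕ 0)) (≗⇒≈ (⊛-zeroʳ (coeff 0))) ⟩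
      𝟘 ⊛ mono (s *ℕ 0)                        ≈⟨ ≗⇒≈ (⊛-comm 𝟘 (mono (s *ℕ 0))) ⟩
      mono (s *ℕ 0) ⊛ 𝟘                        ≈⟨ ≗⇒≈ (⊛-zeroʳ (mono (s *ℕ 0))) ⟩
      𝟘                                        ∎
      where
      oneMinus-zero : oneMinus 0 ≗ 𝟘
      oneMinus-zero zero    = refl
      oneMinus-zero (suc k) = refl

    -- With c = coeff j, all four series are combinations of c q^{sj}, c q^{s(j+1)}, c q^{(s+2)j} and
    -- c q^{α+s+(s+2)j}; for term s (suc j) this needs coeff-suc.
    term-telescopes : ∀ s j → oneMinus s ⊛ (coeff j ⊛ mono (s *ℕ j)) ≈
      (term s j ⊕ ⊖ term s (suc j)) ⊕ oneMinus (α +ℕ s) ⊛ (coeff j ⊛ mono ((s +ℕ 2) *ℕ j))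
    term-telescopes s j = regroup (c ⊛ mono (s *ℕ j)) (c ⊛ mono (s *ℕ suc j))
                                  (c ⊛ mono ((s +ℕ 2) *ℕ j)) (c ⊛ mono ((α +ℕ s) +ℕ (s +ℕ 2) *ℕ j))
      (oneMinus-⊛-mono c s (s *ℕ j) (s *ℕ suc j) (sym (ℕₚ.*-suc s j)))
      (≈-trans (pull (oneMinus (2 *ℕ j)) (mono (s *ℕ j)))
               (oneMinus-⊛-mono c (2 *ℕ j) (s *ℕ j) ((s +ℕ 2) *ℕ j) (e₁ s j)))
      (≈-trans (⊛-congˡ (mono (s *ℕ suc j)) (coeff-suc j))
        (≈-trans (pull (oneMinus (α +ℕ 2 *ℕ j)) (mono (s *ℕ suc j)))
                 (oneMinus-⊛-mono c (α +ℕ 2 *ℕ j) (s *ℕ suc j) ((α +ℕ s) +ℕ (s +ℕ 2) *ℕ j) (e₂ α s j))))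
      (oneMinus-⊛-mono c (α +ℕ s) ((s +ℕ 2) *ℕ j) ((α +ℕ s) +ℕ (s +ℕ 2) *ℕ j) refl)
      where
      c : Series
      c = coeff j
      pull : ∀ x y → (c ⊛ x) ⊛ y ≈ x ⊛ (c ⊛ y)
      pull = solve 3 (λ c x y → (c · x) · y ⊜ x · (c · y)) ≈-refl c
      e₁ : ∀ s j → 2 *ℕ j +ℕ s *ℕ j ≡ (s +ℕ 2) *ℕ j
      e₁ = ℕ-Solver.solve-∀
      e₂ : ∀ α s j → (α +ℕ 2 *ℕ j) +ℕ s *ℕ suc j ≡ (α +ℕ s) +ℕ (s +ℕ 2) *ℕ j
      e₂ = ℕ-Solver.solve-∀
      regroup : ∀ {lhs d₀ d₁ r} u w u′ w′ → lhs ≈ u ⊕ ⊖ w → d₀ ≈ u ⊕ ⊖ u′ → d₁ ≈ w ⊕ ⊖ w′ → r ≈ u′ ⊕ ⊖ w′ →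
                lhs ≈ (d₀ ⊕ ⊖ d₁) ⊕ r
      regroup u w u′ w′ lhs≈ d₀≈ d₁≈ r≈ = agree λ k k≤N → trans (at lhs≈ k k≤N)
        (trans (difference-split (u k) (w k) (u′ k) (w′ k))
               (sym (cong₂ _+_ (cong₂ _-_ (at d₀≈ k k≤N) (at d₁≈ k k≤N)) (at r≈ k k≤N))))
        where
        difference-split : ∀ a b c d → a - b ≡ ((a - c) - (b - d)) + (c - d)
        difference-split = solve-∀

    series-step : ∀ s → 1 ≤ℕ s → oneMinus s ⊛ series s ≈ oneMinus (α +ℕ s) ⊛ series (s +ℕ 2)
    series-step s@(suc _) _ = begin
      oneMinus s ⊛ series s
        ≈⟨ ≗⇒≈ (⊛-sumˢ (oneMinus s) N (λ j → coeff j ⊛ mono (s *ℕ j))) ⟩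
      sumˢ N (λ j → oneMinus s ⊛ (coeff j ⊛ mono (s *ℕ j)))
        ≈⟨ sumˢ-cong N (λ j _ → term-telescopes s j) ⟩
      sumˢ N (λ j → (term s j ⊕ ⊖ term s (suc j)) ⊕ r j)
        ≈⟨ agree (λ k k≤N → trans (sumTo-telescope N (λ j → term s j k) (λ j → r j k))
             (trans (cong₂ (λ a b → (a - b) + sumˢ N r k) (at (term-zero s) k k≤N) (at last-term-vanishes k k≤N))
                    (ℤₚ.+-identityˡ (sumˢ N r k)))) ⟩
      sumˢ N r
        ≈⟨ ≗⇒≈ (⊛-sumˢ (oneMinus (α +ℕ s)) N (λ j → coeff j ⊛ mono ((s +ℕ 2) *ℕ j))) ⟨
      oneMinus (α +ℕ s) ⊛ series (s +ℕ 2)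
        ∎
      where
      r : ℕ → Series
      r j = oneMinus (α +ℕ s) ⊛ (coeff j ⊛ mono ((s +ℕ 2) *ℕ j))
      last-term-vanishes : term s (suc N) ≈ 𝟘
      last-term-vanishes = ⊛-mono-vanishes (coeff (suc N) ⊛ oneMinus (2 *ℕ suc N)) (s *ℕ suc N) (ℕₚ.m≤n*m (suc N) s)

    series-iterate : ∀ s K → 1 ≤ℕ s → poch2 s K ⊛ series s ≈ poch2 (α +ℕ s) K ⊛ series (s +ℕ 2 *ℕ K)
    series-iterate s zero    _   = ⊛-congʳ one (≈-reflexive (cong series (sym (ℕₚ.+-identityʳ s))))
    series-iterate s (suc K) 1≤s = begin
      (O ⊛ poch2 s K) ⊛ series s
        ≈⟨ ≗⇒≈ (⊛-assoc O (poch2 s K) (series s)) ⟩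
      O ⊛ (poch2 s K ⊛ series s)
        ≈⟨ ⊛-congʳ O (series-iterate s K 1≤s) ⟩
      O ⊛ (P ⊛ series (s +ℕ 2 *ℕ K))
        ≈⟨ solve 3 (λ x y z → x · (y · z) ⊜ y · (x · z)) ≈-refl O P (series (s +ℕ 2 *ℕ K)) ⟩
      P ⊛ (O ⊛ series (s +ℕ 2 *ℕ K))
        ≈⟨ ⊛-congʳ P (series-step (s +ℕ 2 *ℕ K) (ℕₚ.≤-trans 1≤s (ℕₚ.m≤m+n s (2 *ℕ K)))) ⟩
      P ⊛ (oneMinus (α +ℕ (s +ℕ 2 *ℕ K)) ⊛ series ((s +ℕ 2 *ℕ K) +ℕ 2))
        ≈⟨ ⊛-congʳ P (⊛-cong (≈-reflexive (cong oneMinus (sym (ℕₚ.+-assoc α s (2 *ℕ K)))))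
                             (≈-reflexive (cong series (e s K)))) ⟩
      P ⊛ (oneMinus ((α +ℕ s) +ℕ 2 *ℕ K) ⊛ series (s +ℕ 2 *ℕ suc K))
        ≈⟨ solve 3 (λ x y z → x · (y · z) ⊜ (y · x) · z) ≈-refl P (oneMinus ((α +ℕ s) +ℕ 2 *ℕ K)) (series (s +ℕ 2 *ℕ suc K)) ⟩
      (oneMinus ((α +ℕ s) +ℕ 2 *ℕ K) ⊛ P) ⊛ series (s +ℕ 2 *ℕ suc K)
        ∎
      where
      O P : Series
      O = oneMinus (s +ℕ 2 *ℕ K)
      P = poch2 (α +ℕ s) K
      e : ∀ s K → (s +ℕ 2 *ℕ K) +ℕ 2 ≡ s +ℕ 2 *ℕ suc K
      e = ℕ-Solver.solve-∀

    series≈one : ∀ t → N <ℕ t → series t ≈ one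
    series≈one t N<t = agree λ k k≤N → trans (sumTo-pick N 0 _ z≤n (higher-terms-vanish k k≤N))
      (trans (cong (λ m → (coeff 0 ⊛ mono m) k) (ℕₚ.*-zeroʳ t))
             (trans (⊛-identityʳ (coeff 0) k) (⊛-identityˡ one k)))
      where
      higher-terms-vanish : ∀ k → k ≤ℕ N → ∀ j → j ≤ℕ N → j ≢ 0 → (coeff j ⊛ mono (t *ℕ j)) k ≡ 0ℤ
      higher-terms-vanish k k≤N zero    _ j≢0 = ⊥-elim (j≢0 refl)
      higher-terms-vanish k k≤N (suc j) _ _   =
        at (⊛-mono-vanishes (coeff (suc j)) (t *ℕ suc j) (ℕₚ.<-≤-trans N<t (ℕₚ.m≤m*n t (suc j)))) k k≤N

    q-binomial : ∀ s K → 1 ≤ℕ s → N <ℕ s +ℕ 2 *ℕ K → series s ≈ poch2 (α +ℕ s) K ⊛ invPoch2 s K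
    q-binomial s K 1≤s N<s+2K = begin
      series s
        ≈⟨ ≗⇒≈ (⊛-identityˡ (series s)) ⟨
      one ⊛ series s
        ≈⟨ ⊛-congˡ (series s) (poch2-⊛-invPoch2 s K 1≤s) ⟨
      (poch2 s K ⊛ invPoch2 s K) ⊛ series s
        ≈⟨ solve 3 (λ x y z → (x · y) · z ⊜ y · (x · z)) ≈-refl (poch2 s K) (invPoch2 s K) (series s) ⟩
      invPoch2 s K ⊛ (poch2 s K ⊛ series s)
        ≈⟨ ⊛-congʳ (invPoch2 s K) (series-iterate s K 1≤s) ⟩
      invPoch2 s K ⊛ (poch2 (α +ℕ s) K ⊛ series (s +ℕ 2 *ℕ K))
        ≈⟨ ⊛-congʳ (invPoch2 s K) (⊛-congʳ (poch2 (α +ℕ s) K) (series≈one _ N<s+2K)) ⟩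
      invPoch2 s K ⊛ (poch2 (α +ℕ s) K ⊛ one)
        ≈⟨ solve 2 (λ x y → x · (y · ε) ⊜ y · x) ≈-refl (invPoch2 s K) (poch2 (α +ℕ s) K) ⟩
      poch2 (α +ℕ s) K ⊛ invPoch2 s K
        ∎

  ⊛-≈one : ∀ {f g} → f ≈ one → g ≈ one → f ⊛ g ≈ one
  ⊛-≈one f≈1 g≈1 = ≈-trans (⊛-cong f≈1 g≈1) (≗⇒≈ (⊛-identityˡ one))

  -- With K = N + 1 factors, every product below agrees with its infinite version up to q^N.
  K : ℕ
  K = suc N

  N<+2K : ∀ a → N <ℕ a +ℕ 2 *ℕ K
  N<+2K a = ℕₚ.<-≤-trans (ℕₚ.n<1+n N) (ℕₚ.≤-trans (ℕₚ.m≤n*m K 2) (ℕₚ.m≤n+m (2 *ℕ K) a))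

  poch2-peel : ∀ a k → poch2 a K ≈ poch2 (a +ℕ 2 *ℕ k) K ⊛ poch2 a k
  poch2-peel a k = stepProd-peel oneMinus a K k oneMinus≈one (N<+2K a)

  invPoch2-peel : ∀ a k → invPoch2 a K ≈ invPoch2 (a +ℕ 2 *ℕ k) K ⊛ invPoch2 a k
  invPoch2-peel a k = stepProd-peel geom a K k geom≈one (N<+2K a)

  module B₁ = QBinomial 1
  module B₇ = QBinomial 7

  Ψ : Series
  Ψ = poch2 2 K ⊛ invPoch2 1 K

  ratio-expansion : ∀ n → poch2 (2 *ℕ n +ℕ 2) K ⊛ invPoch2 (2 *ℕ n +ℕ 1) K ≈ Ψ ⊛ B₁.coeff n
  ratio-expansion n = ≈-sym (begin
    (poch2 2 K ⊛ invPoch2 1 K) ⊛ (poch2 1 n ⊛ invPoch2 2 n)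
      ≈⟨ ⊛-congˡ (poch2 1 n ⊛ invPoch2 2 n) (⊛-cong (poch2-peel 2 n) (invPoch2-peel 1 n)) ⟩
    ((P ⊛ poch2 2 n) ⊛ (I ⊛ invPoch2 1 n)) ⊛ (poch2 1 n ⊛ invPoch2 2 n)
      ≈⟨ solve 6 (λ p p₂ i i₁ p₁ i₂ → ((p · p₂) · (i · i₁)) · (p₁ · i₂) ⊜ (p · i) · ((p₂ · i₂) · (p₁ · i₁)))
               ≈-refl P (poch2 2 n) I (invPoch2 1 n) (poch2 1 n) (invPoch2 2 n) ⟩
    (P ⊛ I) ⊛ ((poch2 2 n ⊛ invPoch2 2 n) ⊛ (poch2 1 n ⊛ invPoch2 1 n))
      ≈⟨ cancelʳ (P ⊛ I) (⊛-≈one (poch2-⊛-invPoch2 2 n (s≤s z≤n)) (poch2-⊛-invPoch2 1 n (s≤s z≤n))) ⟩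
    P ⊛ I
      ≈⟨ ⊛-cong (≈-reflexive (cong (λ a → poch2 a K) (ℕₚ.+-comm 2 (2 *ℕ n))))
                (≈-reflexive (cong (λ a → invPoch2 a K) (ℕₚ.+-comm 1 (2 *ℕ n)))) ⟩
    poch2 (2 *ℕ n +ℕ 2) K ⊛ invPoch2 (2 *ℕ n +ℕ 1) K
      ∎)
    where
    P I : Series
    P = poch2 (2 +ℕ 2 *ℕ n) K
    I = invPoch2 (1 +ℕ 2 *ℕ n) K

  outer : ℕ → Series
  outer k = (Ψ ⊛ B₇.coeff k) ⊛ mono (suc k)

  inner : ℕ → ℕ → Series
  inner k n = B₁.coeff n ⊛ mono ((2 *ℕ k +ℕ 2) *ℕ n)

  summand-expansion : ∀ n → summand n K ≈ sumˢ N (λ k → outer k ⊛ inner k n)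
  summand-expansion n = begin
    (((m ⊛ P₂) ⊛ P₈) ⊛ I) ⊛ I
      ≈⟨ solve 4 (λ m p₂ p₈ i → (((m · p₂) · p₈) · i) · i ⊜ (m · (p₂ · i)) · (p₈ · i)) ≈-refl m P₂ P₈ I ⟩
    (m ⊛ (P₂ ⊛ I)) ⊛ (P₈ ⊛ I)
      ≈⟨ ⊛-cong (⊛-congʳ m (ratio-expansion n)) (≈-sym (≈-trans (B₇.q-binomial (2 *ℕ n +ℕ 1) K (ℕₚ.m≤n+m 1 (2 *ℕ n)) (N<+2K _))
                                                              (⊛-congˡ I (≈-reflexive (cong (λ a → poch2 a K) (exponent₈ n)))))) ⟩
    (m ⊛ (Ψ ⊛ B₁.coeff n)) ⊛ B₇.series (2 *ℕ n +ℕ 1)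
      ≈⟨ ≗⇒≈ (⊛-sumˢ (m ⊛ (Ψ ⊛ B₁.coeff n)) N (λ k → B₇.coeff k ⊛ mono ((2 *ℕ n +ℕ 1) *ℕ k))) ⟩
    sumˢ N (λ k → (m ⊛ (Ψ ⊛ B₁.coeff n)) ⊛ (B₇.coeff k ⊛ mono ((2 *ℕ n +ℕ 1) *ℕ k)))
      ≈⟨ sumˢ-cong N (λ k _ → regroup k) ⟩
    sumˢ N (λ k → outer k ⊛ inner k n)
      ∎
    where
    m P₂ P₈ I : Series
    m = mono (2 *ℕ n +ℕ 1)
    P₂ = poch2 (2 *ℕ n +ℕ 2) K
    P₈ = poch2 (2 *ℕ n +ℕ 8) K
    I = invPoch2 (2 *ℕ n +ℕ 1) K
    exponent₈ : ∀ n → 7 +ℕ (2 *ℕ n +ℕ 1) ≡ 2 *ℕ n +ℕ 8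
    exponent₈ = ℕ-Solver.solve-∀
    exponents : ∀ n k → (2 *ℕ n +ℕ 1) +ℕ (2 *ℕ n +ℕ 1) *ℕ k ≡ suc k +ℕ (2 *ℕ k +ℕ 2) *ℕ n
    exponents = ℕ-Solver.solve-∀
    regroup : ∀ k → (m ⊛ (Ψ ⊛ B₁.coeff n)) ⊛ (B₇.coeff k ⊛ mono ((2 *ℕ n +ℕ 1) *ℕ k)) ≈ outer k ⊛ inner k n
    regroup k = begin
      (m ⊛ (Ψ ⊛ c₁)) ⊛ (c₇ ⊛ m′)
        ≈⟨ solve 5 (λ m ψ c₁ c₇ m′ → (m · (ψ · c₁)) · (c₇ · m′) ⊜ (ψ · c₇) · (c₁ · (m · m′))) ≈-refl m Ψ c₁ c₇ m′ ⟩
      (Ψ ⊛ c₇) ⊛ (c₁ ⊛ (m ⊛ m′))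
        ≈⟨ ⊛-congʳ (Ψ ⊛ c₇) (⊛-congʳ c₁ (≗⇒≈ (mono-exchange _ _ (suc k) ((2 *ℕ k +ℕ 2) *ℕ n) (exponents n k)))) ⟩
      (Ψ ⊛ c₇) ⊛ (c₁ ⊛ (mono (suc k) ⊛ mono ((2 *ℕ k +ℕ 2) *ℕ n)))
        ≈⟨ solve 4 (λ x c₁ y z → x · (c₁ · (y · z)) ⊜ (x · y) · (c₁ · z)) ≈-refl (Ψ ⊛ c₇) c₁ (mono (suc k)) (mono ((2 *ℕ k +ℕ 2) *ℕ n)) ⟩
      outer k ⊛ inner k n
        ∎
      where
      c₁ c₇ m′ : Series
      c₁ = B₁.coeff n
      c₇ = B₇.coeff k
      m′ = mono ((2 *ℕ n +ℕ 1) *ℕ k)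

  I₁₃ : Series
  I₁₃ = invPoch2 1 3

  finite-ratio : ∀ k → poch2 7 k ⊛ invPoch2 1 (suc k) ≈ poch2 (2 *ℕ k +ℕ 3) 2 ⊛ I₁₃
  finite-ratio k = cross-multiply (poch2 7 k) (poch2 1 (suc k)) (invPoch2 1 (suc k))
                                  (poch2 (2 *ℕ k +ℕ 3) 2) (poch2 1 3) I₁₃ split
                                  (poch2-⊛-invPoch2 1 (suc k) (s≤s z≤n)) (poch2-⊛-invPoch2 1 3 (s≤s z≤n))
    where
    split : poch2 7 k ⊛ poch2 1 3 ≈ poch2 (2 *ℕ k +ℕ 3) 2 ⊛ poch2 1 (suc k)
    split = begin
      poch2 7 k ⊛ poch2 1 3
        ≈⟨ stepProd-+ oneMinus 1 k 3 ⟨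
      poch2 1 (k +ℕ 3)
        ≈⟨ ≈-reflexive (cong (poch2 1) (ℕₚ.+-comm k 3)) ⟩
      poch2 1 (2 +ℕ suc k)
        ≈⟨ stepProd-+ oneMinus 1 2 (suc k) ⟩
      poch2 (1 +ℕ 2 *ℕ suc k) 2 ⊛ poch2 1 (suc k)
        ≈⟨ ⊛-congˡ (poch2 1 (suc k)) (≈-reflexive (cong (λ a → poch2 a 2) (e k))) ⟩
      poch2 (2 *ℕ k +ℕ 3) 2 ⊛ poch2 1 (suc k)
        ∎
      where
      e : ∀ k → 1 +ℕ 2 *ℕ suc k ≡ 2 *ℕ k +ℕ 3
      e = ℕ-Solver.solve-∀

  outer-collapse : ∀ k → outer k ⊛ (poch2 (1 +ℕ (2 *ℕ k +ℕ 2)) K ⊛ invPoch2 (2 *ℕ k +ℕ 2) K)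
                         ≈ mono (suc k) ⊛ (poch2 7 k ⊛ invPoch2 1 (suc k))
  outer-collapse k = begin
    ((Ψ ⊛ (poch2 7 k ⊛ invPoch2 2 k)) ⊛ m) ⊛ (P ⊛ I)
      ≈⟨ ⊛-congˡ (P ⊛ I) (⊛-congˡ m (⊛-congˡ (poch2 7 k ⊛ invPoch2 2 k) (⊛-cong (poch2-peel 2 k) (invPoch2-peel 1 (suc k))))) ⟩
    ((((P₀ ⊛ poch2 2 k) ⊛ (I₀ ⊛ invPoch2 1 (suc k))) ⊛ (poch2 7 k ⊛ invPoch2 2 k)) ⊛ m) ⊛ (P ⊛ I)
      ≈⟨ solve 9 (λ p₀ p₂ i₀ i₁ p₇ i₂ m p i →
                    ((((p₀ · p₂) · (i₀ · i₁)) · (p₇ · i₂)) · m) · (p · i)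
                  ⊜ (m · (p₇ · i₁)) · ((p₂ · i₂) · ((p₀ · i) · (p · i₀))))
               ≈-refl P₀ (poch2 2 k) I₀ (invPoch2 1 (suc k)) (poch2 7 k) (invPoch2 2 k) m P I ⟩
    (m ⊛ (poch2 7 k ⊛ invPoch2 1 (suc k))) ⊛ ((poch2 2 k ⊛ invPoch2 2 k) ⊛ ((P₀ ⊛ I) ⊛ (P ⊛ I₀)))
      ≈⟨ cancelʳ (m ⊛ (poch2 7 k ⊛ invPoch2 1 (suc k)))
                 (⊛-≈one (poch2-⊛-invPoch2 2 k (s≤s z≤n)) (⊛-≈one P₀⊛I≈1 P⊛I₀≈1)) ⟩
    m ⊛ (poch2 7 k ⊛ invPoch2 1 (suc k))
      ∎
    where
    m P I P₀ I₀ : Series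
    m = mono (suc k)
    P = poch2 (1 +ℕ (2 *ℕ k +ℕ 2)) K
    I = invPoch2 (2 *ℕ k +ℕ 2) K
    P₀ = poch2 (2 +ℕ 2 *ℕ k) K
    I₀ = invPoch2 (1 +ℕ 2 *ℕ suc k) K
    P₀⊛I≈1 : P₀ ⊛ I ≈ one
    P₀⊛I≈1 = ≈-trans (⊛-congʳ P₀ (≈-reflexive (cong (λ a → invPoch2 a K) (ℕₚ.+-comm (2 *ℕ k) 2))))
                     (poch2-⊛-invPoch2 (2 +ℕ 2 *ℕ k) K (s≤s z≤n))
    P⊛I₀≈1 : P ⊛ I₀ ≈ one
    P⊛I₀≈1 = ≈-trans (⊛-congʳ P (≈-reflexive (cong (λ a → invPoch2 (suc a) K) (trans (ℕₚ.*-suc 2 k) (ℕₚ.+-comm 2 (2 *ℕ k))))))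
                     (poch2-⊛-invPoch2 (1 +ℕ (2 *ℕ k +ℕ 2)) K (s≤s z≤n))

  exchange-summation : sumˢ N (λ n → summand n K) ≈ sumˢ N (λ k → mono (suc k) ⊛ (poch2 (2 *ℕ k +ℕ 3) 2 ⊛ I₁₃))
  exchange-summation = begin
    sumˢ N (λ n → summand n K)
      ≈⟨ sumˢ-cong N (λ n _ → summand-expansion n) ⟩
    sumˢ N (λ n → sumˢ N (λ k → outer k ⊛ inner k n))
      ≈⟨ ≗⇒≈ (sumˢ-comm N N (λ n k → outer k ⊛ inner k n)) ⟩
    sumˢ N (λ k → sumˢ N (λ n → outer k ⊛ inner k n))
      ≈⟨ sumˢ-cong N (λ k _ → ≗⇒≈ (λ j → sym (⊛-sumˢ (outer k) N (inner k) j))) ⟩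
    sumˢ N (λ k → outer k ⊛ B₁.series (2 *ℕ k +ℕ 2))
      ≈⟨ sumˢ-cong N (λ k _ → ⊛-congʳ (outer k) (B₁.q-binomial (2 *ℕ k +ℕ 2) K (ℕₚ.≤-trans (s≤s z≤n) (ℕₚ.m≤n+m 2 (2 *ℕ k))) (N<+2K _))) ⟩
    sumˢ N (λ k → outer k ⊛ (poch2 (1 +ℕ (2 *ℕ k +ℕ 2)) K ⊛ invPoch2 (2 *ℕ k +ℕ 2) K))
      ≈⟨ sumˢ-cong N (λ k _ → ≈-trans (outer-collapse k) (⊛-congʳ (mono (suc k)) (finite-ratio k))) ⟩
    sumˢ N (λ k → mono (suc k) ⊛ (poch2 (2 *ℕ k +ℕ 3) 2 ⊛ I₁₃))
      ∎

  powers : ℕ → ℕ → Series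
  powers m M = sumˢ M (λ k → mono (m *ℕ k))

  powers-⊛-oneMinus : ∀ m M → powers m M ⊛ oneMinus m ≈ one ⊕ ⊖ mono (m *ℕ suc M)
  powers-⊛-oneMinus m zero = begin
    powers m 0 ⊛ oneMinus m      ≈⟨ ⊛-congˡ (oneMinus m) (≈-reflexive (cong mono (ℕₚ.*-zeroʳ m))) ⟩
    one ⊛ oneMinus m             ≈⟨ ≗⇒≈ (⊛-identityˡ (oneMinus m)) ⟩
    one ⊕ ⊖ mono m               ≈⟨ ≈-reflexive (cong (λ e → one ⊕ ⊖ mono e) (sym (ℕₚ.*-identityʳ m))) ⟩
    one ⊕ ⊖ mono (m *ℕ 1)        ∎
  powers-⊛-oneMinus m (suc M) = begin
    (powers m M ⊕ mono (m *ℕ suc M)) ⊛ oneMinus m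
      ≈⟨ ≗⇒≈ (⊛-distribʳ (powers m M) (mono (m *ℕ suc M)) (oneMinus m)) ⟩
    powers m M ⊛ oneMinus m ⊕ mono (m *ℕ suc M) ⊛ oneMinus m
      ≈⟨ ⊕-cong (powers-⊛-oneMinus m M) next ⟩
    (one ⊕ ⊖ mono (m *ℕ suc M)) ⊕ (mono (m *ℕ suc M) ⊕ ⊖ mono (m *ℕ suc (suc M)))
      ≈⟨ ≗⇒≈ (λ n → telescope (one n) (mono (m *ℕ suc M) n) (mono (m *ℕ suc (suc M)) n)) ⟩
    one ⊕ ⊖ mono (m *ℕ suc (suc M))
      ∎
    where
    next : mono (m *ℕ suc M) ⊛ oneMinus m ≈ mono (m *ℕ suc M) ⊕ ⊖ mono (m *ℕ suc (suc M))
    next = ≗⇒≈ λ n → trans (⊛-comm (mono (m *ℕ suc M)) (oneMinus m) n)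
                    (trans (oneMinus⊛mono m (m *ℕ suc M) n) (cong (λ e → mono (m *ℕ suc M) n - mono e n) (sym (ℕₚ.*-suc m (suc M)))))
    telescope : ∀ a b c → (a - b) + (b - c) ≡ a - c
    telescope = solve-∀

  powers≈geom : ∀ m → 1 ≤ℕ m → powers m N ≈ geom m
  powers≈geom m 1≤m = begin
    powers m N
      ≈⟨ cancelʳ (powers m N) oneMinus⊛geom≈1 ⟨
    powers m N ⊛ (oneMinus m ⊛ geom m)
      ≈⟨ ≗⇒≈ (⊛-assoc (powers m N) (oneMinus m) (geom m)) ⟨
    (powers m N ⊛ oneMinus m) ⊛ geom m
      ≈⟨ ⊛-congˡ (geom m) (powers-⊛-oneMinus m N) ⟩
    (one ⊕ ⊖ mono (m *ℕ suc N)) ⊛ geom m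
      ≈⟨ ⊛-congˡ (geom m) (⊕-cong (≈-refl {one}) (⊖-cong (mono-vanishes (m *ℕ suc N) N<m*K))) ⟩
    (one ⊕ ⊖ 𝟘) ⊛ geom m
      ≈⟨ ⊛-congˡ (geom m) (≗⇒≈ (λ n → ℤₚ.+-identityʳ (one n))) ⟩
    one ⊛ geom m
      ≈⟨ ≗⇒≈ (⊛-identityˡ (geom m)) ⟩
    geom m
      ∎
    where
    oneMinus⊛geom≈1 : oneMinus m ⊛ geom m ≈ one
    oneMinus⊛geom≈1 = ≗⇒≈ (λ n → trans (⊛-comm (oneMinus m) (geom m) n) (geom-⊛-oneMinus m 1≤m n))
    N<m*K : N <ℕ m *ℕ suc N
    N<m*K = ℕₚ.≤-trans (ℕₚ.≤-reflexive (sym (ℕₚ.*-identityˡ (suc N)))) (ℕₚ.*-monoˡ-≤ (suc N) 1≤m)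

  geometric-sum : ∀ m a → 1 ≤ℕ m → sumˢ N (λ k → mono (m *ℕ k +ℕ a)) ≈ mono a ⊛ geom m
  geometric-sum m a 1≤m = begin
    sumˢ N (λ k → mono (m *ℕ k +ℕ a))
      ≈⟨ sumˢ-cong N (λ k _ → ≈-trans (≈-reflexive (cong mono (ℕₚ.+-comm (m *ℕ k) a))) (≈-sym (≗⇒≈ (mono-+ a (m *ℕ k))))) ⟩
    sumˢ N (λ k → mono a ⊛ mono (m *ℕ k))
      ≈⟨ ≗⇒≈ (⊛-sumˢ (mono a) N (λ k → mono (m *ℕ k))) ⟨
    mono a ⊛ powers m N
      ≈⟨ ⊛-congʳ (mono a) (powers≈geom m 1≤m) ⟩
    mono a ⊛ geom m
      ∎

  monomial-expansion : ∀ k → mono (suc k) ⊛ poch2 (2 *ℕ k +ℕ 3) 2 ≈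
    (mono (1 *ℕ k +ℕ 1) ⊕ ⊖ mono (3 *ℕ k +ℕ 4)) ⊕ ⊖ (mono (3 *ℕ k +ℕ 6) ⊕ ⊖ mono (5 *ℕ k +ℕ 9))
  monomial-expansion k = begin
    m ⊛ (oneMinus b ⊛ (oneMinus a ⊛ one))
      ≈⟨ solve 3 (λ m x y → m · (x · (y · ε)) ⊜ x · (y · m)) ≈-refl m (oneMinus b) (oneMinus a) ⟩
    oneMinus b ⊛ (oneMinus a ⊛ m)
      ≈⟨ ⊛-congʳ (oneMinus b) (≗⇒≈ (oneMinus⊛mono a (suc k))) ⟩
    oneMinus b ⊛ (m ⊕ ⊖ mono (a +ℕ suc k))
      ≈⟨ ≗⇒≈ (oneMinus-⊛ b (m ⊕ ⊖ mono (a +ℕ suc k))) ⟩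
    (m ⊕ ⊖ mono (a +ℕ suc k)) ⊕ ⊖ (mono b ⊛ (m ⊕ ⊖ mono (a +ℕ suc k)))
      ≈⟨ ⊕-cong (≈-refl {m ⊕ ⊖ mono (a +ℕ suc k)}) (⊖-cong (≗⇒≈ λ n →
           trans (⊛-distribˡ (mono b) m (⊖ mono (a +ℕ suc k)) n)
                 (cong₂ _+_ (mono-+ b (suc k) n) (trans (⊛-negʳ (mono b) (mono (a +ℕ suc k)) n) (cong -_ (mono-+ b (a +ℕ suc k) n)))))) ⟩
    (m ⊕ ⊖ mono (a +ℕ suc k)) ⊕ ⊖ (mono (b +ℕ suc k) ⊕ ⊖ mono (b +ℕ (a +ℕ suc k)))
      ≈⟨ ≈-reflexive (cong₂ (λ x y → (x ⊕ ⊖ mono y) ⊕ ⊖ (mono (b +ℕ suc k) ⊕ ⊖ mono (b +ℕ (a +ℕ suc k)))) (cong mono (e₁ k)) (e₂ k)) ⟩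
    (mono (1 *ℕ k +ℕ 1) ⊕ ⊖ mono (3 *ℕ k +ℕ 4)) ⊕ ⊖ (mono (b +ℕ suc k) ⊕ ⊖ mono (b +ℕ (a +ℕ suc k)))
      ≈⟨ ≈-reflexive (cong₂ (λ x y → (mono (1 *ℕ k +ℕ 1) ⊕ ⊖ mono (3 *ℕ k +ℕ 4)) ⊕ ⊖ (mono x ⊕ ⊖ mono y)) (e₃ k) (e₄ k)) ⟩
    (mono (1 *ℕ k +ℕ 1) ⊕ ⊖ mono (3 *ℕ k +ℕ 4)) ⊕ ⊖ (mono (3 *ℕ k +ℕ 6) ⊕ ⊖ mono (5 *ℕ k +ℕ 9))
      ∎
    where
    m : Series
    m = mono (suc k)
    a b : ℕ
    a = (2 *ℕ k +ℕ 3) +ℕ 2 *ℕ 0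
    b = (2 *ℕ k +ℕ 3) +ℕ 2 *ℕ 1
    e₁ : ∀ k → suc k ≡ 1 *ℕ k +ℕ 1
    e₁ = ℕ-Solver.solve-∀
    e₂ : ∀ k → ((2 *ℕ k +ℕ 3) +ℕ 2 *ℕ 0) +ℕ suc k ≡ 3 *ℕ k +ℕ 4
    e₂ = ℕ-Solver.solve-∀
    e₃ : ∀ k → ((2 *ℕ k +ℕ 3) +ℕ 2 *ℕ 1) +ℕ suc k ≡ 3 *ℕ k +ℕ 6
    e₃ = ℕ-Solver.solve-∀
    e₄ : ∀ k → ((2 *ℕ k +ℕ 3) +ℕ 2 *ℕ 1) +ℕ (((2 *ℕ k +ℕ 3) +ℕ 2 *ℕ 0) +ℕ suc k) ≡ 5 *ℕ k +ℕ 9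
    e₄ = ℕ-Solver.solve-∀

  sum-of-expansions : sumˢ N (λ k → mono (suc k) ⊛ poch2 (2 *ℕ k +ℕ 3) 2) ≈ closedForm
  sum-of-expansions = begin
    sumˢ N (λ k → mono (suc k) ⊛ poch2 (2 *ℕ k +ℕ 3) 2)
      ≈⟨ sumˢ-cong N (λ k _ → monomial-expansion k) ⟩
    sumˢ N (λ k → (A k ⊕ ⊖ B k) ⊕ ⊖ (C k ⊕ ⊖ D k))
      ≈⟨ ≗⇒≈ (sumˢ-difference N (λ k → A k ⊕ ⊖ B k) (λ k → C k ⊕ ⊖ D k)) ⟩
    sumˢ N (λ k → A k ⊕ ⊖ B k) ⊕ ⊖ sumˢ N (λ k → C k ⊕ ⊖ D k)
      ≈⟨ ⊕-cong (≗⇒≈ (sumˢ-difference N A B)) (⊖-cong (≗⇒≈ (sumˢ-difference N C D))) ⟩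
    (sumˢ N A ⊕ ⊖ sumˢ N B) ⊕ ⊖ (sumˢ N C ⊕ ⊖ sumˢ N D)
      ≈⟨ ⊕-cong (⊕-cong (geometric-sum 1 1 (s≤s z≤n)) (⊖-cong (geometric-sum 3 4 (s≤s z≤n))))
                (⊖-cong (⊕-cong (geometric-sum 3 6 (s≤s z≤n)) (⊖-cong (geometric-sum 5 9 (s≤s z≤n))))) ⟩
    closedForm
      ∎
    where
    A B C D : ℕ → Series
    A k = mono (1 *ℕ k +ℕ 1)
    B k = mono (3 *ℕ k +ℕ 4)
    C k = mono (3 *ℕ k +ℕ 6)
    D k = mono (5 *ℕ k +ℕ 9)

  sum-of-summands : sumˢ N (λ n → summand n K) ≈ closedForm ⊛ I₁₃
  sum-of-summands = begin
    sumˢ N (λ n → summand n K)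
      ≈⟨ exchange-summation ⟩
    sumˢ N (λ k → mono (suc k) ⊛ (poch2 (2 *ℕ k +ℕ 3) 2 ⊛ I₁₃))
      ≈⟨ sumˢ-cong N (λ k _ → ≗⇒≈ (⊛-assoc (mono (suc k)) (poch2 (2 *ℕ k +ℕ 3) 2) I₁₃)) ⟨
    sumˢ N (λ k → (mono (suc k) ⊛ poch2 (2 *ℕ k +ℕ 3) 2) ⊛ I₁₃)
      ≈⟨ ≗⇒≈ (sumˢ-⊛ N (λ k → mono (suc k) ⊛ poch2 (2 *ℕ k +ℕ 3) 2) I₁₃) ⟨
    sumˢ N (λ k → mono (suc k) ⊛ poch2 (2 *ℕ k +ℕ 3) 2) ⊛ I₁₃
      ≈⟨ ⊛-congˡ I₁₃ sum-of-expansions ⟩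
    closedForm ⊛ I₁₃
      ∎

Nonnegative : Series → Set
Nonnegative f = ∀ k → 0ℤ ≤ f k

*-nonneg : ∀ {x y} → 0ℤ ≤ x → 0ℤ ≤ y → 0ℤ ≤ x * y
*-nonneg {ℤ.pos a} {ℤ.pos b} _ _ = subst (0ℤ ≤_) (ℤₚ.pos-* a b) (+≤+ z≤n)

⊛-nonneg : ∀ {f g} → Nonnegative f → Nonnegative g → Nonnegative (f ⊛ g)
⊛-nonneg 0≤f 0≤g n = sumTo-nonneg n _ (λ i _ → *-nonneg (0≤f i) (0≤g (n ∸ i)))

indicator-nonneg : ∀ b → 0ℤ ≤ indicator b
indicator-nonneg true  = +≤+ z≤n
indicator-nonneg false = +≤+ z≤n

prodTo-nonneg : ∀ K (F : ℕ → Series) → (∀ j → Nonnegative (F j)) → Nonnegative (prodTo K F)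
prodTo-nonneg zero    F _     k = indicator-nonneg (does (k ℕ.≟ 0))
prodTo-nonneg (suc K) F 0≤F = ⊛-nonneg (0≤F K) (prodTo-nonneg K F 0≤F)

invPoch2-nonneg : ∀ a K → Nonnegative (invPoch2 a K)
invPoch2-nonneg a K = prodTo-nonneg K _ (λ j k → indicator-nonneg (does ((a +ℕ 2 *ℕ j) ∣? k)))

inProgression : ℕ → ℕ → ℕ → Bool
inProgression a m n = (a ℕ.≤ᵇ n) ∧ does (m ∣? (n ∸ a))

mono⊛geom : ∀ a m n → (mono a ⊛ geom m) n ≡ indicator (inProgression a m n)
mono⊛geom a m n with a ℕ.≤ᵇ n | ℕₚ.≤ᵇ-reflects-≤ a n
... | true  | ofʸ a≤n = trans (⊛-comm (mono a) (geom m) n) (⊛-mono (geom m) a n a≤n)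
... | false | ofⁿ a≰n = trans (⊛-comm (mono a) (geom m) n) (⊛-mono-< (geom m) a n (ℕₚ.≰⇒> a≰n))

inProgression-sound : ∀ a m n → T (inProgression a m n) → a ≤ℕ n × m ∣ (n ∸ a)
inProgression-sound a m n t with a ℕ.≤ᵇ n | ℕₚ.≤ᵇ-reflects-≤ a n | m ∣? (n ∸ a)
... | true | ofʸ a≤n | yes m∣n∸a = a≤n , m∣n∸a

inProgression-complete : ∀ a m n → a ≤ℕ n → m ∣ (n ∸ a) → T (inProgression a m n)
inProgression-complete a m n a≤n m∣n∸a with a ℕ.≤ᵇ n | ℕₚ.≤ᵇ-reflects-≤ a n | m ∣? (n ∸ a)
... | true  | _        | yes _ = tt
... | true  | _        | no m∤ = m∤ m∣n∸a
... | false | ofⁿ a≰n  | _     = a≰n a≤n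

combination-nonneg : ∀ a b c d → (T b → T c → ⊥) → (T b ⊎ T c → T a) →
  0ℤ ≤ (indicator a - indicator b) - (indicator c - indicator d)
combination-nonneg true  true  true  _     b∧c _ = ⊥-elim (b∧c tt tt)
combination-nonneg true  true  false false _ _ = +≤+ z≤n
combination-nonneg true  true  false true  _ _ = +≤+ z≤n
combination-nonneg true  false true  false _ _ = +≤+ z≤n
combination-nonneg true  false true  true  _ _ = +≤+ z≤n
combination-nonneg true  false false false _ _ = +≤+ z≤n
combination-nonneg true  false false true  _ _ = +≤+ z≤n
combination-nonneg false true  _     _     _ b∨c⇒a = ⊥-elim (b∨c⇒a (inj₁ tt))
combination-nonneg false false true  _     _ b∨c⇒a = ⊥-elim (b∨c⇒a (inj₂ tt))
combination-nonneg false false false false _ _ = +≤+ z≤n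
combination-nonneg false false false true  _ _ = +≤+ z≤n

¬3∣-both : ∀ n → 6 ≤ℕ n → 3 ∣ n ∸ 4 → 3 ∣ n ∸ 6 → ⊥
¬3∣-both _ (s≤s (s≤s (s≤s (s≤s (s≤s (s≤s {n = t} _)))))) 3∣t+2 3∣t =
  ℕₚ.<⇒≱ (s≤s (s≤s (s≤s z≤n))) (∣⇒≤ (∣m+n∣m⇒∣n (subst (3 ∣_) (ℕₚ.+-comm 2 t) 3∣t+2) 3∣t))

closedForm-nonneg : Nonnegative closedForm
closedForm-nonneg n = subst (0ℤ ≤_) (sym coefficient)
  (combination-nonneg (inProgression 1 1 n) (inProgression 4 3 n) (inProgression 6 3 n) (inProgression 9 5 n)
                      disjoint covered)
  where
  coefficient : closedForm n ≡ (indicator (inProgression 1 1 n) - indicator (inProgression 4 3 n))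
                               - (indicator (inProgression 6 3 n) - indicator (inProgression 9 5 n))
  coefficient = cong₂ _-_ (cong₂ _-_ (mono⊛geom 1 1 n) (mono⊛geom 4 3 n)) (cong₂ _-_ (mono⊛geom 6 3 n) (mono⊛geom 9 5 n))
  disjoint : T (inProgression 4 3 n) → T (inProgression 6 3 n) → ⊥
  disjoint in₄ in₆ = let (_ , 3∣n∸4) = inProgression-sound 4 3 n in₄ ; (6≤n , 3∣n∸6) = inProgression-sound 6 3 n in₆
                     in ¬3∣-both n 6≤n 3∣n∸4 3∣n∸6
  positive : ∀ a → T (inProgression (suc a) 3 n) → T (inProgression 1 1 n)
  positive a in′ = inProgression-complete 1 1 n (ℕₚ.≤-trans (s≤s z≤n) (proj₁ (inProgression-sound (suc a) 3 n in′))) (1∣ _)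
  covered : T (inProgression 4 3 n) ⊎ T (inProgression 6 3 n) → T (inProgression 1 1 n)
  covered (inj₁ in₄) = positive 3 in₄
  covered (inj₂ in₆) = positive 5 in₆

theorem2p6 : (n : ℕ) → 0ℤ ≤ C'41 n
theorem2p6 N = subst (0ℤ ≤_) (sym (at sum-of-summands N ℕₚ.≤-refl))
                     (⊛-nonneg closedForm-nonneg (invPoch2-nonneg 1 3) N)
  where open UpTo N
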